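{- The ladder graph $\mathbb{Z}\times\mathbb{Z}_2$ does not admit a harmonic labeling.
   Context: The ladder graph $\mathbb{Z}\times\mathbb{Z}_2$ has vertex set $\mathbb{Z}\times\{0,1\}$, where $(i,a)\sim(j,b)$ iff either $a=b$ and $|i-j|=1$, or $i=j$ and $a\neq b$; every vertex has degree 3. A function $\phi:V\to\mathbb{Z}$ is harmonic if $\phi(x)=\frac{1}{\deg(x)}\sum_{y\sim x}\phi(y)$ for all vertices $x$. A harmonic labeling is a harmonic function $\phi:V\to\mathbb{Z}$ that is a bijection onto $\mathbb{Z}$. -}

module Defs where

open import Data.Bool using (Bool; not)
open import Data.Integer using (ℤ; _+_; _-_; _*_; +_; ∣_∣)
open import Data.Product using (_×_; _,_)
open import Data.Sum using (_⊎_)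
open import Data.List using (List; _∷_; []; map; foldr; length)
open import Function using (Bijective)
open import Relation.Binary.PropositionalEquality using (_≡_)

Vertex : Set
Vertex = ℤ × Bool

_∼_ : Vertex → Vertex → Set
(i , a) ∼ (j , b) = (a ≡ b × ∣ i - j ∣ ≡ 1) ⊎ (i ≡ j × b ≡ not a)

sumℤ : List ℤ → ℤ
sumℤ = foldr _+_ (+ 0)

neighbours : Vertex → List Vertex
neighbours (i , a) = (i - + 1 , a) ∷ (i + + 1 , a) ∷ (i , not a) ∷ []

deg : Vertex → ℤ
deg x = + length (neighbours x)

-- φ harmonic: φ(x) = (1/deg x) Σ_{y∼x} φ(y), written with the
-- denominator cleared: deg(x) · φ(x) = Σ_{y∼x} φ(y).
Harmonic : (Vertex → ℤ) → Set
Harmonic φ = ∀ x → deg x * φ x ≡ sumℤ (map φ (neighbours x))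

HarmonicLabeling : (Vertex → ℤ) → Set
HarmonicLabeling φ = Harmonic φ × Bijective _≡_ _≡_ φ

-- Let φ be harmonic and injective.  On the right half-ladder write u and v for
-- the values of φ on the two rails (columns 0, 1, 2, …).  Harmonicity makes the
-- rung difference d = u - v satisfy d(m+2) = 4 d(m+1) - d(m) and makes the rung
-- sum s = u + v an arithmetic progression.  Injectivity gives d(m) ≠ 0, and then
-- |d| eventually triples at every step, so it outgrows every affine function; as
-- |s| grows only linearly, so do |u| and |v|.  The reflection i ↦ -i preserves
-- harmonicity, so the same holds on the left half-ladder.  Hence for some K all
-- vertices with |φ| ≤ 4K lie in the window of columns |i| < K, which has at most
-- 4K vertices; a bijection onto ℤ would have to place the 4K + 1 values 0, …, 4K
-- there, contradicting the pigeonhole principle.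

module Submission where

open import Defs
open import Data.Integer using (ℤ; +_; -[1+_]; ∣_∣)
open import Relation.Nullary using (¬_; yes; no; contradiction)
open import Data.Bool using (Bool; true; false; not)
open import Data.Empty using (⊥)
open import Data.Fin as Fin using (Fin; toℕ; fromℕ<; _↑ˡ_; _↑ʳ_; splitAt)
import Data.Fin.Properties as FinP
import Data.Integer.Properties as ℤP
open import Data.Integer.Tactic.RingSolver as ℤSolver using ()
open import Data.Nat as ℕ using (ℕ; zero; suc; z≤n; s≤s)
import Data.Nat.Properties as ℕP
open import Data.Nat.Tactic.RingSolver as ℕSolver using ()
open import Data.Product using (_×_; _,_; proj₁; proj₂; ∃-syntax)
open import Function using (_∘_; Injective; Bijective)
open import Relation.Binary.PropositionalEquality

module EventualBehaviour where
  open import Data.Nat using (_+_; _*_; _≤_)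

  Eventually : (ℕ → Set) → Set
  Eventually P = ∃[ K ] (∀ m → K ≤ m → P m)

  eventually-map : {P Q : ℕ → Set} → (∀ {m} → P m → Q m) → Eventually P → Eventually Q
  eventually-map f (K , p) = K , λ m K≤m → f (p m K≤m)

  eventually-× : {P Q : ℕ → Set} → Eventually P → Eventually Q → Eventually (λ m → P m × Q m)
  eventually-× (K , p) (L , q) =
    K + L , λ m K+L≤m → p m (ℕP.≤-trans (ℕP.m≤m+n K L) K+L≤m)
                       , q m (ℕP.≤-trans (ℕP.m≤n+m L K) K+L≤m)

  eventually-shift : {P : ℕ → Set} (n : ℕ) → Eventually (λ j → P (j + n)) → Eventually P
  eventually-shift {P} n (K , p) = K + n , shifted
    where
    shifted : ∀ m → K + n ≤ m → P m
    shifted m K+n≤m =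
      subst P (ℕP.m∸n+n≡m (ℕP.m+n≤o⇒n≤o K K+n≤m)) (p (m ℕ.∸ n) (ℕP.m+n≤o⇒m≤o∸n K K+n≤m))

  OutgrowsLinear : (ℕ → ℕ) → Set
  OutgrowsLinear E = ∀ A B → Eventually (λ m → A + B * m ≤ E m)

  outgrows-shift : (n : ℕ) (E : ℕ → ℕ) → OutgrowsLinear (λ j → E (j + n)) → OutgrowsLinear E
  outgrows-shift n E outgrows A B =
    eventually-shift n (eventually-map rearrange (outgrows (A + B * n) B))
    where
    rearrange : ∀ {j} → A + B * n + B * j ≤ E (j + n) → A + B * (j + n) ≤ E (j + n)
    rearrange {j} = subst (_≤ E (j + n)) (distribute A B j n)
      where
      distribute : ∀ A B j n → A + B * n + B * j ≡ A + B * (j + n)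
      distribute = ℕSolver.solve-∀

  quadratic-outgrows : (F : ℕ → ℕ) → (∀ j → j * j + 1 ≤ F (suc j)) → OutgrowsLinear F
  quadratic-outgrows F quadratic A B = suc (suc (A + B + B)) , beyond
    where
    beyond : ∀ m → suc (suc (A + B + B)) ≤ m → A + B * m ≤ F m
    beyond (suc (suc j′)) (s≤s (s≤s A+2B≤j′)) = begin
        A + B * suc j            ≡⟨ regroup A B j ⟩
        (A + B) + B * j          ≤⟨ ℕP.+-monoˡ-≤ (B * j) (ℕP.m≤m*n (A + B) j) ⟩
        (A + B) * j + B * j      ≡⟨ ℕP.*-distribʳ-+ j (A + B) B ⟨
        (A + B + B) * j          ≤⟨ ℕP.*-monoˡ-≤ j (ℕP.m≤n⇒m≤1+n A+2B≤j′) ⟩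
        j * j                    ≤⟨ ℕP.m≤m+n (j * j) 1 ⟩
        j * j + 1                ≤⟨ quadratic j ⟩
        F (suc j)                ∎
      where
      open ℕP.≤-Reasoning
      j : ℕ
      j = suc j′
      regroup : ∀ A B j → A + B * suc j ≡ (A + B) + B * j
      regroup = ℕSolver.solve-∀

open EventualBehaviour

module DominantRecurrence where
  open import Data.Nat using (_+_; _*_; _≤_; _≤?_)

  non-descent : (E : ℕ → ℕ) → ∃[ n ] (E n ≤ E (suc n))
  non-descent E = descend (E 0) 0 ℕP.≤-refl
    where
    -- the bound b on E m limits the number of further strict descents
    descend : ∀ b m → E m ≤ b → ∃[ n ] (E n ≤ E (suc n))
    descend b m Em≤b with E m ≤? E (suc m)
    ... | yes ascent = m , ascent
    descend zero    m Em≤0 | no descent = contradiction (ℕP.≤-trans Em≤0 z≤n) descent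
    descend (suc b) m Em≤b | no descent =
      descend b (suc m) (ℕP.≤-pred (ℕP.≤-trans (ℕP.≰⇒> descent) Em≤b))

  -- Sequences with 4E(m+1) ≤ E(m+2) + E(m), such as |d| for d(m+2) = 4d(m+1) - d(m).
  module _ (E : ℕ → ℕ) (dominant : ∀ m → 4 * E (suc m) ≤ E (suc (suc m)) + E m) where

    triples : ∀ m → E m ≤ E (suc m) → 3 * E (suc m) ≤ E (suc (suc m))
    triples m Em≤Em+1 = ℕP.+-cancelʳ-≤ (E (suc m)) _ _ (begin
        3 * E (suc m) + E (suc m)          ≡⟨ ℕP.+-comm (3 * E (suc m)) (E (suc m)) ⟩
        4 * E (suc m)                      ≤⟨ dominant m ⟩
        E (suc (suc m)) + E m              ≤⟨ ℕP.+-monoʳ-≤ (E (suc (suc m))) Em≤Em+1 ⟩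
        E (suc (suc m)) + E (suc m)        ∎)
      where open ℕP.≤-Reasoning

    module _ (start : E 0 ≤ E 1) where
      nondecreasing : ∀ j → E j ≤ E (suc j)
      nondecreasing zero    = start
      nondecreasing (suc j) =
        ℕP.≤-trans (ℕP.m≤n*m (E (suc j)) 3) (triples j (nondecreasing j))

      quadratic : 1 ≤ E 1 → ∀ j → j * j + 1 ≤ E (suc j)
      quadratic positive zero    = positive
      quadratic positive (suc j) = begin
          suc j * suc j + 1      ≤⟨ square-step j ⟩
          3 * (j * j + 1)        ≤⟨ ℕP.*-monoʳ-≤ 3 (quadratic positive j) ⟩
          3 * E (suc j)          ≤⟨ triples j (nondecreasing j) ⟩
          E (suc (suc j))        ∎
        where
        open ℕP.≤-Reasoning
        -- (j+1)² + 1 ≤ 3(j² + 1), since the difference is 2j² - 2j + 1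
        square-step : ∀ j → suc j * suc j + 1 ≤ 3 * (j * j + 1)
        square-step zero    = s≤s (s≤s z≤n)
        square-step (suc k) =
          ℕP.≤-trans (ℕP.m≤m+n _ (2 * k * k + 2 * k + 1)) (ℕP.≤-reflexive (expand k))
          where
          expand : ∀ k → suc (suc k) * suc (suc k) + 1 + (2 * k * k + 2 * k + 1)
                         ≡ 3 * (suc k * suc k + 1)
          expand = ℕSolver.solve-∀

  -- A positive sequence with 4E(m+1) ≤ E(m+2) + E(m) outgrows every affine function:
  -- after its first non-descent it triples at each step.
  dominant-outgrows : (E : ℕ → ℕ) → (∀ m → 1 ≤ E m) →
                      (∀ m → 4 * E (suc m) ≤ E (suc (suc m)) + E m) → OutgrowsLinear E
  dominant-outgrows E positive dominant =
    outgrows-shift n E (quadratic-outgrows F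
      (quadratic F (λ m → dominant (m + n)) start (positive (suc n))))
    where
    n : ℕ
    n = proj₁ (non-descent E)
    start : E n ≤ E (suc n)
    start = proj₂ (non-descent E)
    F : ℕ → ℕ
    F j = E (j + n)

open DominantRecurrence

module HalfLadder where
  open import Data.Integer using (_+_; _-_; _*_)

  -- The harmonic equation at column m+1 of a half-ladder, solved for the outer
  -- neighbour on rail u; v is the opposite rail.
  RailRecurrence : (ℕ → ℤ) → (ℕ → ℤ) → Set
  RailRecurrence u v = ∀ m → u (suc (suc m)) ≡ + 3 * u (suc m) - u m - v (suc m)

  -- For d(m+2) = 4d(m+1) - d(m), the absolute values satisfy the hypothesis of
  -- dominant-outgrows (triangle inequality for 4d(m+1) = d(m+2) + d(m)).
  four-recurrence-abs : (d : ℕ → ℤ) → (∀ m → d (suc (suc m)) ≡ + 4 * d (suc m) - d m) →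
                        ∀ m → 4 ℕ.* ∣ d (suc m) ∣ ℕ.≤ ∣ d (suc (suc m)) ∣ ℕ.+ ∣ d m ∣
  four-recurrence-abs d recurrence m = begin
      4 ℕ.* ∣ d (suc m) ∣                    ≡⟨ ℤP.∣i*j∣≡∣i∣*∣j∣ (+ 4) (d (suc m)) ⟨
      ∣ + 4 * d (suc m) ∣                    ≡⟨ cong ∣_∣ (split (+ 4 * d (suc m)) (d m)) ⟩
      ∣ (+ 4 * d (suc m) - d m) + d m ∣      ≤⟨ ℤP.∣i+j∣≤∣i∣+∣j∣ (+ 4 * d (suc m) - d m) (d m) ⟩
      ∣ + 4 * d (suc m) - d m ∣ ℕ.+ ∣ d m ∣  ≡⟨ cong (λ x → ∣ x ∣ ℕ.+ ∣ d m ∣) (recurrence m) ⟨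
      ∣ d (suc (suc m)) ∣ ℕ.+ ∣ d m ∣        ∎
    where
    open ℕP.≤-Reasoning
    split : ∀ a b → a ≡ (a - b) + b
    split = ℤSolver.solve-∀

  arithmetic-bound : (s : ℕ → ℤ) → (∀ m → s (suc (suc m)) ≡ + 2 * s (suc m) - s m) →
                     ∀ m → ∣ s m ∣ ℕ.≤ ∣ s 0 ∣ ℕ.+ m ℕ.* ∣ s 1 - s 0 ∣
  arithmetic-bound s recurrence = bound
    where
    step : ℤ
    step = s 1 - s 0

    constant-step : ∀ m → s (suc m) - s m ≡ step
    constant-step zero    = refl
    constant-step (suc m) = begin
        s (suc (suc m)) - s (suc m)             ≡⟨ cong (_- s (suc m)) (recurrence m) ⟩
        (+ 2 * s (suc m) - s m) - s (suc m)     ≡⟨ cancel (s m) (s (suc m)) ⟩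
        s (suc m) - s m                         ≡⟨ constant-step m ⟩
        step                                    ∎
      where
      open ≡-Reasoning
      cancel : ∀ a b → (+ 2 * b - a) - b ≡ b - a
      cancel = ℤSolver.solve-∀

    next : ∀ m → s (suc m) ≡ s m + step
    next m = trans (telescope (s m) (s (suc m))) (cong (λ x → s m + x) (constant-step m))
      where
      telescope : ∀ a b → b ≡ a + (b - a)
      telescope = ℤSolver.solve-∀

    bound : ∀ m → ∣ s m ∣ ℕ.≤ ∣ s 0 ∣ ℕ.+ m ℕ.* ∣ step ∣
    bound zero    = ℕP.m≤m+n (∣ s 0 ∣) 0
    bound (suc m) = begin
        ∣ s (suc m) ∣                                  ≡⟨ cong ∣_∣ (next m) ⟩
        ∣ s m + step ∣                                 ≤⟨ ℤP.∣i+j∣≤∣i∣+∣j∣ (s m) step ⟩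
        ∣ s m ∣ ℕ.+ ∣ step ∣                           ≤⟨ ℕP.+-monoˡ-≤ (∣ step ∣) (bound m) ⟩
        ∣ s 0 ∣ ℕ.+ m ℕ.* ∣ step ∣ ℕ.+ ∣ step ∣        ≡⟨ collect (∣ s 0 ∣) m (∣ step ∣) ⟩
        ∣ s 0 ∣ ℕ.+ suc m ℕ.* ∣ step ∣                 ∎
      where
      open ℕP.≤-Reasoning
      collect : ∀ a m b → a ℕ.+ m ℕ.* b ℕ.+ b ≡ a ℕ.+ suc m ℕ.* b
      collect = ℕSolver.solve-∀

  -- On a half-ladder with distinct values on each rung, each rail outgrows every
  -- affine function: |d| does by dominant-outgrows, |s| grows linearly, and
  -- d = 2u - s gives |d| ≤ 2|u| + |s|.
  rail-outgrows : (u v : ℕ → ℤ) → RailRecurrence u v → RailRecurrence v u →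
                  (∀ m → u m ≢ v m) → OutgrowsLinear (λ m → ∣ u m ∣)
  rail-outgrows u v u-rec v-rec rungs A B =
    eventually-map halve
      (dominant-outgrows (∣_∣ ∘ d) d-positive (four-recurrence-abs d d-rec)
        (2 ℕ.* A ℕ.+ ∣ s 0 ∣) (2 ℕ.* B ℕ.+ ∣ t ∣))
    where
    d s : ℕ → ℤ
    d m = u m - v m
    s m = u m + v m

    t : ℤ
    t = s 1 - s 0

    d-rec : ∀ m → d (suc (suc m)) ≡ + 4 * d (suc m) - d m
    d-rec m rewrite u-rec m | v-rec m = difference (u m) (u (suc m)) (v m) (v (suc m))
      where
      difference : ∀ u₀ u₁ v₀ v₁ →
                   (+ 3 * u₁ - u₀ - v₁) - (+ 3 * v₁ - v₀ - u₁) ≡ + 4 * (u₁ - v₁) - (u₀ - v₀)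
      difference = ℤSolver.solve-∀

    s-rec : ∀ m → s (suc (suc m)) ≡ + 2 * s (suc m) - s m
    s-rec m rewrite u-rec m | v-rec m = sum (u m) (u (suc m)) (v m) (v (suc m))
      where
      sum : ∀ u₀ u₁ v₀ v₁ →
            (+ 3 * u₁ - u₀ - v₁) + (+ 3 * v₁ - v₀ - u₁) ≡ + 2 * (u₁ + v₁) - (u₀ + v₀)
      sum = ℤSolver.solve-∀

    d-positive : ∀ m → 1 ℕ.≤ ∣ d m ∣
    d-positive m with ∣ d m ∣ in ∣dm∣≡
    ... | zero  = contradiction (ℤP.i-j≡0⇒i≡j (u m) (v m) (ℤP.∣i∣≡0⇒i≡0 ∣dm∣≡)) (rungs m)
    ... | suc _ = s≤s z≤n

    d-bound : ∀ m → ∣ d m ∣ ℕ.≤ 2 ℕ.* ∣ u m ∣ ℕ.+ ∣ s m ∣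
    d-bound m = begin
        ∣ d m ∣                         ≡⟨ cong ∣_∣ (twice-minus-sum (u m) (v m)) ⟩
        ∣ + 2 * u m - s m ∣             ≤⟨ ℤP.∣i-j∣≤∣i∣+∣j∣ (+ 2 * u m) (s m) ⟩
        ∣ + 2 * u m ∣ ℕ.+ ∣ s m ∣       ≡⟨ cong (ℕ._+ ∣ s m ∣) (ℤP.∣i*j∣≡∣i∣*∣j∣ (+ 2) (u m)) ⟩
        2 ℕ.* ∣ u m ∣ ℕ.+ ∣ s m ∣       ∎
      where
      open ℕP.≤-Reasoning
      twice-minus-sum : ∀ a b → a - b ≡ + 2 * a - (a + b)
      twice-minus-sum = ℤSolver.solve-∀

    halve : ∀ {m} → 2 ℕ.* A ℕ.+ ∣ s 0 ∣ ℕ.+ (2 ℕ.* B ℕ.+ ∣ t ∣) ℕ.* m ℕ.≤ ∣ d m ∣ →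
            A ℕ.+ B ℕ.* m ℕ.≤ ∣ u m ∣
    halve {m} large = ℕP.*-cancelˡ-≤ 2 (ℕP.+-cancelʳ-≤ (∣ s m ∣) _ _ (begin
        2 ℕ.* (A ℕ.+ B ℕ.* m) ℕ.+ ∣ s m ∣
          ≤⟨ ℕP.+-monoʳ-≤ (2 ℕ.* (A ℕ.+ B ℕ.* m)) (arithmetic-bound s s-rec m) ⟩
        2 ℕ.* (A ℕ.+ B ℕ.* m) ℕ.+ (∣ s 0 ∣ ℕ.+ m ℕ.* ∣ t ∣)
          ≡⟨ regroup A B m (∣ s 0 ∣) (∣ t ∣) ⟩
        2 ℕ.* A ℕ.+ ∣ s 0 ∣ ℕ.+ (2 ℕ.* B ℕ.+ ∣ t ∣) ℕ.* m
          ≤⟨ large ⟩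
        ∣ d m ∣
          ≤⟨ d-bound m ⟩
        2 ℕ.* ∣ u m ∣ ℕ.+ ∣ s m ∣ ∎))
      where
      open ℕP.≤-Reasoning
      regroup : ∀ A B m a b → 2 ℕ.* (A ℕ.+ B ℕ.* m) ℕ.+ (a ℕ.+ m ℕ.* b)
                              ≡ 2 ℕ.* A ℕ.+ a ℕ.+ (2 ℕ.* B ℕ.+ b) ℕ.* m
      regroup = ℕSolver.solve-∀

open HalfLadder

module TheLadder where
  open import Data.Integer using (_+_; _-_; _*_; -_)

  rungs-differ : {φ : Vertex → ℤ} → Injective _≡_ _≡_ φ → ∀ i → φ (i , true) ≢ φ (i , false)
  rungs-differ injective i same with injective same
  ... | ()

  harmonic-forward : {φ : Vertex → ℤ} → Harmonic φ →
                     ∀ i a → φ (i + + 1 , a) ≡ + 3 * φ (i , a) - φ (i - + 1 , a) - φ (i , not a)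
  harmonic-forward {φ} harmonic i a =
    isolate (+ 3 * φ (i , a)) (φ (i - + 1 , a)) (φ (i + + 1 , a)) (φ (i , not a)) (harmonic (i , a))
    where
    isolate : ∀ x l r o → x ≡ l + (r + (o + + 0)) → r ≡ x - l - o
    isolate x l r o eq = trans (solved l r o) (cong (λ y → y - l - o) (sym eq))
      where
      solved : ∀ l r o → r ≡ (l + (r + (o + + 0))) - l - o
      solved = ℤSolver.solve-∀

  rail-recurrence : {φ : Vertex → ℤ} → Harmonic φ →
                    ∀ a → RailRecurrence (λ m → φ (+ m , a)) (λ m → φ (+ m , not a))
  rail-recurrence {φ} harmonic a m =
    subst (λ i → φ (i , a) ≡ + 3 * φ (+ suc m , a) - φ (+ m , a) - φ (+ suc m , not a))
          (cong (+_ ∘ suc) (ℕP.+-comm m 1))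
          (harmonic-forward harmonic (+ suc m) a)

  rails-outgrow : {φ : Vertex → ℤ} → Harmonic φ → Injective _≡_ _≡_ φ →
                  ∀ a → OutgrowsLinear (λ m → ∣ φ (+ m , a) ∣)
  rails-outgrow harmonic injective true =
    rail-outgrows _ _ (rail-recurrence harmonic true) (rail-recurrence harmonic false)
                  (λ m → rungs-differ injective (+ m))
  rails-outgrow harmonic injective false =
    rail-outgrows _ _ (rail-recurrence harmonic false) (rail-recurrence harmonic true)
                  (λ m → rungs-differ injective (+ m) ∘ sym)

  reflect : Vertex → Vertex
  reflect (i , a) = - i , a

  reflect-harmonic : {φ : Vertex → ℤ} → Harmonic φ → Harmonic (φ ∘ reflect)
  reflect-harmonic {φ} harmonic (i , a) = begin
      + 3 * φ (- i , a)
        ≡⟨ harmonic (- i , a) ⟩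
      φ (- i - + 1 , a) + (φ (- i + + 1 , a) + (φ (- i , not a) + + 0))
        ≡⟨ swap (φ (- i - + 1 , a)) (φ (- i + + 1 , a)) _ ⟩
      φ (- i + + 1 , a) + (φ (- i - + 1 , a) + (φ (- i , not a) + + 0))
        ≡⟨ cong₂ (λ l r → φ (l , a) + (φ (r , a) + (φ (- i , not a) + + 0)))
                 (neg-minus i) (neg-plus i) ⟨
      φ (- (i - + 1) , a) + (φ (- (i + + 1) , a) + (φ (- i , not a) + + 0))
        ∎
    where
    open ≡-Reasoning
    swap : ∀ x y z → x + (y + z) ≡ y + (x + z)
    swap = ℤSolver.solve-∀
    neg-minus : ∀ i → - (i - + 1) ≡ - i + + 1
    neg-minus = ℤSolver.solve-∀
    neg-plus : ∀ i → - (i + + 1) ≡ - i - + 1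
    neg-plus = ℤSolver.solve-∀

  reflect-injective : {φ : Vertex → ℤ} → Injective _≡_ _≡_ φ → Injective _≡_ _≡_ (φ ∘ reflect)
  reflect-injective injective same =
    cong₂ _,_ (ℤP.neg-injective (cong proj₁ (injective same))) (cong proj₂ (injective same))

  far-columns-large : {φ : Vertex → ℤ} → Harmonic φ → Injective _≡_ _≡_ φ →
                      ∃[ K ] (∀ i a → K ℕ.≤ ∣ i ∣ → 1 ℕ.+ 4 ℕ.* ∣ i ∣ ℕ.≤ ∣ φ (i , a) ∣)
  far-columns-large {φ} harmonic injective = K , large
    where
    LargeAt : ℕ → Vertex → Set
    LargeAt m x = 1 ℕ.+ 4 ℕ.* m ℕ.≤ ∣ φ x ∣

    FourRails : ℕ → Set
    FourRails m = (LargeAt m (+ m , true) × LargeAt m (+ m , false))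
                × (LargeAt m (- (+ m) , true) × LargeAt m (- (+ m) , false))

    right : ∀ a → OutgrowsLinear (λ m → ∣ φ (+ m , a) ∣)
    right = rails-outgrow harmonic injective

    left : ∀ a → OutgrowsLinear (λ m → ∣ φ (- (+ m) , a) ∣)
    left = rails-outgrow (reflect-harmonic harmonic) (reflect-injective injective)

    four-rails : Eventually FourRails
    four-rails = eventually-× (eventually-× (right true 1 4) (right false 1 4))
                              (eventually-× (left true 1 4) (left false 1 4))

    K : ℕ
    K = proj₁ four-rails

    large : ∀ i a → K ℕ.≤ ∣ i ∣ → LargeAt ∣ i ∣ (i , a)
    large (+ m)    true  K≤m = proj₁ (proj₁ (proj₂ four-rails m K≤m))
    large (+ m)    false K≤m = proj₂ (proj₁ (proj₂ four-rails m K≤m))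
    large -[1+ k ] true  K≤m = proj₁ (proj₂ (proj₂ four-rails (suc k) K≤m))
    large -[1+ k ] false K≤m = proj₂ (proj₂ (proj₂ four-rails (suc k) K≤m))

open TheLadder

module Counting where
  open import Data.Nat using (_+_; _*_; _≤_; _<_)

  tag : ∀ {n} → Bool → Fin n → Fin (n + n)
  tag {n} true  c = c ↑ˡ n
  tag {n} false c = n ↑ʳ c

  tag-injective : ∀ {n} a b (c e : Fin n) → tag a c ≡ tag b e → a ≡ b × c ≡ e
  tag-injective true  true  c e same = refl , FinP.↑ˡ-injective _ c e same
  tag-injective false false c e same = refl , FinP.↑ʳ-injective _ c e same
  tag-injective {n} true false c e same =
    contradiction (trans (sym (FinP.splitAt-↑ˡ n c n))
                         (trans (cong (splitAt n) same) (FinP.splitAt-↑ʳ n n e))) λ ()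
  tag-injective {n} false true c e same =
    contradiction (trans (sym (FinP.splitAt-↑ʳ n n c))
                         (trans (cong (splitAt n) same) (FinP.splitAt-↑ˡ n e n))) λ ()

  column-code : ∀ K i → ∣ i ∣ < K → Fin (K + K)
  column-code K (+ m)     m<K  = tag true  (fromℕ< m<K)
  column-code K -[1+ k ]  k+1<K = tag false (fromℕ< (ℕP.<⇒≤ k+1<K))

  column-code-injective : ∀ K i j p q → column-code K i p ≡ column-code K j q → i ≡ j
  column-code-injective K (+ m) (+ n) p q same =
    cong +_ (FinP.fromℕ<-injective m n p q (proj₂ (tag-injective true true _ _ same)))
  column-code-injective K -[1+ k ] -[1+ l ] p q same =
    cong -[1+_] (FinP.fromℕ<-injective k l _ _ (proj₂ (tag-injective false false _ _ same)))
  column-code-injective K (+ m) -[1+ l ] p q same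
    with () ← proj₁ (tag-injective true false _ _ same)
  column-code-injective K -[1+ k ] (+ n) p q same
    with () ← proj₁ (tag-injective false true _ _ same)

  -- The number of vertices in the window of columns |i| < K, as coded below.
  windowSize : ℕ → ℕ
  windowSize K = (K + K) + (K + K)

  windowSize-≡ : ∀ K → windowSize K ≡ 4 * K
  windowSize-≡ K = quadruple K
    where
    quadruple : ∀ K → (K + K) + (K + K) ≡ 4 * K
    quadruple = ℕSolver.solve-∀

  vertex-code : ∀ K (x : Vertex) → ∣ proj₁ x ∣ < K → Fin (windowSize K)
  vertex-code K (i , a) inside = tag a (column-code K i inside)

  vertex-code-injective : ∀ K x y p q → vertex-code K x p ≡ vertex-code K y q → x ≡ y
  vertex-code-injective K (i , a) (j , b) p q same =
    let a≡b , codes≡ = tag-injective a b _ _ same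
    in cong₂ _,_ (column-code-injective K i j p q codes≡) a≡b

  -- A bijection onto ℤ cannot keep all vertices with |φ| ≤ 4K inside the window
  -- |i| < K: the preimages of 0, …, 4K would be 4K + 1 distinct window vertices.
  not-confined : (φ : Vertex → ℤ) → Bijective _≡_ _≡_ φ → (K : ℕ) →
                 ¬ (∀ x → ∣ φ x ∣ ≤ windowSize K → ∣ proj₁ x ∣ < K)
  not-confined φ (injective , surjective) K confined =
    collision (FinP.pigeonhole (ℕP.n<1+n (windowSize K)) code)
    where
    preimage : Fin (suc (windowSize K)) → Vertex
    preimage k = proj₁ (surjective (+ toℕ k))

    preimage-value : ∀ k → φ (preimage k) ≡ + toℕ k
    preimage-value k = proj₂ (surjective (+ toℕ k)) refl

    preimage-small : ∀ k → ∣ φ (preimage k) ∣ ≤ windowSize K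
    preimage-small k rewrite preimage-value k = ℕP.≤-pred (FinP.toℕ<n k)

    code : Fin (suc (windowSize K)) → Fin (windowSize K)
    code k = vertex-code K (preimage k) (confined (preimage k) (preimage-small k))

    collision : ∃[ k ] ∃[ l ] (k Fin.< l × code k ≡ code l) → ⊥
    collision (k , l , k<l , same-code) = FinP.<-irrefl k≡l k<l
      where
      open ≡-Reasoning
      k≡l : k ≡ l
      k≡l = FinP.toℕ-injective (ℤP.+-injective (begin
          + toℕ k             ≡⟨ preimage-value k ⟨
          φ (preimage k)      ≡⟨ cong φ (vertex-code-injective K _ _ _ _ same-code) ⟩
          φ (preimage l)      ≡⟨ preimage-value l ⟩
          + toℕ l             ∎))

open Counting

mainTheorem4 : (φ : Vertex → ℤ) → ¬ HarmonicLabeling φ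
mainTheorem4 φ (harmonic , bijective@(injective , _)) = not-confined φ bijective K confined
  where
  K : ℕ
  K = proj₁ (far-columns-large harmonic injective)
  large : ∀ i a → K ℕ.≤ ∣ i ∣ → 1 ℕ.+ 4 ℕ.* ∣ i ∣ ℕ.≤ ∣ φ (i , a) ∣
  large = proj₂ (far-columns-large harmonic injective)

  confined : ∀ x → ∣ φ x ∣ ℕ.≤ windowSize K → ∣ proj₁ x ∣ ℕ.< K
  confined (i , a) small with K ℕ.≤? ∣ i ∣
  ... | no  i<K = ℕP.≰⇒> i<K
  ... | yes K≤i = contradiction small (ℕP.<⇒≱ (begin-strict
      windowSize K         ≡⟨ windowSize-≡ K ⟩
      4 ℕ.* K              ≤⟨ ℕP.*-monoʳ-≤ 4 K≤i ⟩
      4 ℕ.* ∣ i ∣          <⟨ ℕP.n<1+n _ ⟩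
      1 ℕ.+ 4 ℕ.* ∣ i ∣    ≤⟨ large i a K≤i ⟩
      ∣ φ (i , a) ∣        ∎))
    where open ℕP.≤-Reasoning
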